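{- Let $k\le r$ be positive integers and $n_1,\dots,n_r$ non-negative integers with $n=n_1+\dots+n_r\ge1$, and put $t_k=n_1+\dots+n_k$. Then $V_k(n_1,\dots,n_r)=M(n_1,\dots,n_r)+M(n_1/2,\dots,n_r/2)$ if $t_k\equiv2\pmod4$ and $2\mid\gcd(n_1,\dots,n_r)$, and $V_k(n_1,\dots,n_r)=M(n_1,\dots,n_r)$ otherwise.
   Context: For non-negative integers $n_1,\dots,n_s$ with $n=n_1+\dots+n_s\ge1$, define $$M(n_1,\dots,n_s)=\frac1n\sum_{d\mid\gcd(n_1,\dots,n_s)}\mu(d)\frac{(n/d)!}{(n_1/d)!\cdots(n_s/d)!},$$ where $\mu$ is the Möbius function (gcd ignoring zero entries). For $1\le k\le s$, with $t_k=n_1+\dots+n_k$, $$V_k(n_1,\dots,n_s)=\frac{(-1)^{t_k}}{n}\sum_{d\mid\gcd(n_1,\dots,n_s)}\mu(d)(-1)^{t_k/d}\frac{(n/d)!}{(n_1/d)!\cdots(n_s/d)!}.$$ -}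

module Defs where

open import Data.Nat as ℕ using (ℕ; zero; suc; _+_; _*_; _!; NonZero)
open import Data.Nat.Properties using (_!≢0)
open import Data.Nat.Divisibility using (_∣_; _∣?_)
open import Data.Nat.GCD using (gcd)
open import Data.Nat.Primality using (prime?)
open import Data.Integer as ℤ using (ℤ; +_; -[1+_])
open import Data.Rational as ℚ using (ℚ; 0ℚ; 1ℚ)
open import Data.List using (List; []; _∷_; map; foldr; upTo; filter; length; take)
open import Data.Nat.ListAction using (sum)
open import Data.Bool using (Bool; true; false; if_then_else_)
open import Relation.Nullary.Decidable using (does; _×-dec_)

range1 : ℕ → List ℕ
range1 m = map suc (upTo m)

-- Möbius function (for d ≥ 1): μ(d) = 0 if p² ∣ d for some prime p,
-- otherwise (-1)^(number of distinct primes dividing d).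
-- (All primes dividing d ≥ 1 lie in 1..d.)
primeDivisors : ℕ → List ℕ
primeDivisors d = filter (λ p → prime? p ×-dec (p ∣? d)) (range1 d)

squareFree : ℕ → Bool
squareFree d = go (primeDivisors d)
  where
  go : List ℕ → Bool
  go [] = true
  go (p ∷ ps) = if does ((p * p) ∣? d) then false else go ps

μ : ℕ → ℤ
μ d = if squareFree d then (ℤ.-1ℤ ℤ.^ length (primeDivisors d)) else + 0

-- gcd of a list of naturals (zero entries are ignored automatically,
-- since gcd 0 m = m)
gcdList : List ℕ → ℕ
gcdList = foldr gcd 0

divisors : ℕ → List ℕ
divisors m = filter (λ d → d ∣? m) (range1 m)

sumℚ : List ℚ → ℚ
sumℚ = foldr ℚ._+_ 0ℚ

prodℚ : List ℚ → ℚ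
prodℚ = foldr ℚ._*_ 1ℚ

ℕtoℚ : ℕ → ℚ
ℕtoℚ m = (+ m) ℚ./ 1

invFact : ℕ → ℚ
invFact m = ((+ 1) ℚ./ (m !)) {{m !≢0}}

-- exact division of naturals by d (d ≥ 1 in every use; returns 0 for d = 0)
divBy : ℕ → ℕ → ℕ
divBy zero    m = 0
divBy (suc e) m = m ℕ./ suc e

multinom : List ℕ → ℕ → ℚ
multinom ns d = ℕtoℚ (divBy d (sum ns) !) ℚ.* prodℚ (map (λ m → invFact (divBy d m)) ns)

-- the rational number x / m  (convention: 0 when m = 0; only used with m ≥ 1)
divℚ : ℚ → ℕ → ℚ
divℚ x zero    = 0ℚ
divℚ x (suc m) = x ℚ.* ((+ 1) ℚ./ suc m)

ℤtoℚ : ℤ → ℚ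
ℤtoℚ z = z ℚ./ 1

M : List ℕ → ℚ
M ns = divℚ (sumℚ (map (λ d → ℤtoℚ (μ d) ℚ.* multinom ns d) (divisors (gcdList ns)))) (sum ns)

tk : ℕ → List ℕ → ℕ
tk k ns = sum (take k ns)

sgn : ℕ → ℤ
sgn m = ℤ.-1ℤ ℤ.^ m

V : ℕ → List ℕ → ℚ
V k ns = ℤtoℚ (sgn (tk k ns)) ℚ.*
  divℚ (sumℚ (map (λ d → ℤtoℚ (μ d ℤ.* sgn (divBy d (tk k ns))) ℚ.* multinom ns d)
                  (divisors (gcdList ns))))
       (sum ns)

halve : List ℕ → List ℕ
halve = map (λ m → m ℕ./ 2)

{-# OPTIONS --safe #-}
-- Put t = t_k and g = gcd(n₁,…,n_r). Every d ∣ g divides t, and the d-th summands of V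
-- and M differ by the sign (-1)^(t + t/d), which is -1 exactly when d is even and t/d
-- odd. As μ(d) = 0 when 4 ∣ d, only d = 2e with e odd matters, and then t/d is odd iff
-- t ≡ 2 (mod 4); so V = M unless t ≡ 2 (mod 4) and 2 ∣ g. In that case g = 2h with h odd,
-- the even divisors of g are the 2e with e ∣ h, and since μ(2e) = -μ(e) the summand of M
-- at 2e is -μ(e) (m/e)!/∏((nᵢ/2)/e)! with m = n/2. Flipping the sign of these summands
-- adds 2 Σ_{e ∣ h} μ(e) (m/e)!/∏((nᵢ/2)/e)!, and dividing by n = 2m gives M(n₁/2,…,n_r/2).
module Submission where

open import Defs
open import Data.Nat using (ℕ; _≤_; _%_)
open import Data.Nat.Divisibility using (_∣_)
open import Data.Vec using (Vec; toList)
open import Data.Nat.ListAction using (sum)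
open import Data.Rational using (_+_)
open import Data.Product using (_×_)
open import Relation.Nullary using (¬_)
open import Relation.Binary.PropositionalEquality using (_≡_)

open import Data.Nat as ℕ using (zero; suc; _*_; _<_; NonZero; s≤s; s<s)
import Data.Nat.Properties as ℕₚ
open import Data.Nat.Tactic.RingSolver using (solve-∀)
open import Data.Nat.Divisibility
  using (_∤_; _∣?_; divides; ∣-refl; ∣-trans; ∣⇒≤; _∣0; n∣m*n; ∣m⇒∣m*n; ∣n⇒∣m*n; ∣m∣n⇒∣m+n;
         *-monoˡ-∣; *-cancelʳ-∣; m%n≡0⇒n∣m; n∣m⇒m%n≡0)
open import Data.Nat.DivMod using (_/_; m≡m%n+[m/n]*n; m%n<n; m%n*o≡m*o%[n*o]; m/n*n≡m; m*n/o*n≡m/o)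
open import Data.Nat.GCD using (gcd; gcd[m,n]∣m; gcd[m,n]∣n; c*gcd[m,n]≡gcd[cm,cn])
open import Data.Nat.Coprimality using (Coprime; coprime-divisor)
open import Data.Nat.Primality
  using (Prime; prime?; prime[2]; irreducible[2]; prime⇒irreducible; prime⇒nonZero; prime⇒nonTrivial; euclidsLemma; ¬prime[1])
open import Data.Integer as ℤ using (ℤ; +_; -[1+_]; +[1+_]; 0ℤ; 1ℤ; -1ℤ)
import Data.Integer.Properties as ℤₚ
import Data.Rational as ℚ
import Data.Rational.Properties as ℚₚ
import Data.Rational.Unnormalised as ℚᵘ
import Data.Rational.Unnormalised.Properties as ℚᵘₚ
open import Data.List using (List; []; _∷_; map; filter; length)
open import Data.List.Properties using (map-∘; map-cong-local)
open import Data.List.Membership.Propositional using (_∈_)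
open import Data.List.Membership.Propositional.Properties using (∈-map⁺; ∈-map⁻; ∈-upTo⁺; ∈-filter⁺; ∈-filter⁻)
open import Data.List.Relation.Binary.Subset.Propositional using (_⊆_)
open import Data.List.Relation.Unary.Any using (here; there)
open import Data.List.Relation.Unary.All as All using (All; []; _∷_)
import Data.List.Relation.Unary.All.Properties as All
open import Data.List.Relation.Unary.AllPairs as AllPairs using (AllPairs; []; _∷_)
import Data.List.Relation.Unary.AllPairs.Properties as AllPairs
open import Data.Bool using (Bool; true; false; if_then_else_)
open import Data.Product using (_,_; proj₁; proj₂)
open import Data.Sum using (inj₁; inj₂; [_,_]′)
open import Function using (_∘_; id)
open import Function.Bundles using (_⇔_; mk⇔; Equivalence)
import Function.Properties.Equivalence as ⇔
open import Relation.Nullary using (yes; no; contradiction)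
open import Relation.Nullary.Decidable using (_×-dec_; does; dec-true; dec-false; does-⇔)
open import Relation.Unary using (Pred; Decidable)
open import Relation.Binary.PropositionalEquality using (refl; sym; trans; cong; cong₂; subst; module ≡-Reasoning)
open import Algebra.Bundles using (CommutativeMonoid)
open import Algebra.Properties.CommutativeSemigroup ℤₚ.*-commutativeSemigroup using () renaming (x∙yz≈y∙xz to ℤ-x*yz≡y*xz)
open import Algebra.Properties.CommutativeSemigroup (CommutativeMonoid.commutativeSemigroup ℚₚ.+-0-commutativeMonoid) using () renaming (interchange to ℚ-+-interchange)
open import Algebra.Properties.AbelianGroup ℚₚ.+-0-abelianGroup using () renaming (⁻¹-involutive to ℚ-neg-involutive)

private
  variable
    A : Set
    d e m n q t : ℕ
    ns : List ℕ

-- Parity and signs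

2∤⇒%2≡1 : 2 ∤ m → m % 2 ≡ 1
2∤⇒%2≡1 {m} 2∤m with m % 2 in eq | m%n<n m 2
... | 0           | _               = contradiction (m%n≡0⇒n∣m m 2 eq) 2∤m
... | 1           | _               = refl
... | suc (suc _) | s≤s (s≤s ())

2∤m*n⇔2∤m×2∤n : 2 ∤ m * n ⇔ (2 ∤ m × 2 ∤ n)
2∤m*n⇔2∤m×2∤n {m} {n} = mk⇔
  (λ 2∤mn → 2∤mn ∘ ∣m⇒∣m*n n , 2∤mn ∘ ∣n⇒∣m*n m)
  (λ (2∤m , 2∤n) 2∣mn → [ 2∤m , 2∤n ]′ (euclidsLemma m n prime[2] 2∣mn))

[m*2]%4≡2⇔2∤m : m * 2 % 4 ≡ 2 ⇔ 2 ∤ m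
[m*2]%4≡2⇔2∤m {m} = mk⇔ to from
  where
  [m*2]%4≡[m%2]*2 : m * 2 % 4 ≡ m % 2 * 2
  [m*2]%4≡[m%2]*2 = sym (m%n*o≡m*o%[n*o] m 2 2)
  to : m * 2 % 4 ≡ 2 → 2 ∤ m
  to eq 2∣m = contradiction (trans (sym eq) (trans [m*2]%4≡[m%2]*2 (cong (_* 2) (n∣m⇒m%n≡0 m 2 2∣m)))) λ ()
  from : 2 ∤ m → m * 2 % 4 ≡ 2
  from 2∤m = trans [m*2]%4≡[m%2]*2 (cong (_* 2) (2∤⇒%2≡1 2∤m))

[q*[e*2]]%4≡2⇔2∤q×2∤e : q * (e * 2) % 4 ≡ 2 ⇔ (2 ∤ q × 2 ∤ e)
[q*[e*2]]%4≡2⇔2∤q×2∤e {q} {e} rewrite sym (ℕₚ.*-assoc q e 2) =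
  ⇔.trans [m*2]%4≡2⇔2∤m 2∤m*n⇔2∤m×2∤n

2∤⇒4∤*2 : 2 ∤ e → 2 * 2 ∤ e * 2
2∤⇒4∤*2 2∤e = 2∤e ∘ *-cancelʳ-∣ 2

2∤m⇒coprime[m,2] : 2 ∤ m → Coprime m 2
2∤m⇒coprime[m,2] 2∤m (d∣m , d∣2) with irreducible[2] d∣2
... | inj₁ d≡1 = d≡1
... | inj₂ refl = contradiction d∣m 2∤m

sgn-even : 2 ∣ m → sgn m ≡ 1ℤ
sgn-even (divides k refl) = begin
  -1ℤ ℤ.^ (k * 2)     ≡⟨ cong (-1ℤ ℤ.^_) (ℕₚ.*-comm k 2) ⟩
  -1ℤ ℤ.^ (2 * k)     ≡⟨ ℤₚ.^-*-assoc -1ℤ 2 k ⟨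
  1ℤ ℤ.^ k            ≡⟨ ℤₚ.^-zeroˡ k ⟩
  1ℤ                  ∎
  where open ≡-Reasoning

sgn-odd : 2 ∤ m → sgn m ≡ -1ℤ
sgn-odd {m} 2∤m = begin
  sgn m                   ≡⟨ cong sgn (trans (m≡m%n+[m/n]*n m 2) (cong (ℕ._+ m / 2 * 2) (2∤⇒%2≡1 2∤m))) ⟩
  -1ℤ ℤ.* sgn (m / 2 * 2) ≡⟨ cong (-1ℤ ℤ.*_) (sgn-even (n∣m*n (m / 2))) ⟩
  -1ℤ                     ∎
  where open ≡-Reasoning

sgn*sgn≡1 : ∀ m → sgn m ℤ.* sgn m ≡ 1ℤ
sgn*sgn≡1 m with 2 ∣? m
... | yes 2∣m rewrite sgn-even 2∣m = refl
... | no  2∤m rewrite sgn-odd 2∤m  = refl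

sgn-quotient : q * d ≡ t → 2 * 2 ∤ d → ¬ (t % 4 ≡ 2 × 2 ∣ d) → sgn t ≡ sgn q
sgn-quotient {q} {d} refl 4∤d ¬twisted with 2 ∣? q
... | yes 2∣q = trans (sgn-even (∣m⇒∣m*n d 2∣q)) (sym (sgn-even 2∣q))
... | no  2∤q with 2 ∣? d
...   | no  2∤d = trans (sgn-odd (Equivalence.from 2∤m*n⇔2∤m×2∤n (2∤q , 2∤d))) (sym (sgn-odd 2∤q))
...   | yes 2∣d@(divides e refl) =
  contradiction (Equivalence.from ([q*[e*2]]%4≡2⇔2∤q×2∤e {q} {e}) (2∤q , 4∤d ∘ *-monoˡ-∣ 2) , 2∣d) ¬twisted

quotient-odd : q * d ≡ t → t % 4 ≡ 2 → 2 ∣ d → 2 ∤ q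
quotient-odd {q} refl t%4≡2 (divides e refl) = proj₁ (Equivalence.to ([q*[e*2]]%4≡2⇔2∤q×2∤e {q} {e}) t%4≡2)

-- Lists of divisors

increasing-⊆-≡ : {xs ys : List ℕ} → AllPairs _<_ xs → AllPairs _<_ ys → xs ⊆ ys → ys ⊆ xs → xs ≡ ys
increasing-⊆-≡ [] [] _ _ = refl
increasing-⊆-≡ [] (_ ∷ _) _ ys⊆xs with () ← ys⊆xs (here refl)
increasing-⊆-≡ (_ ∷ _) [] xs⊆ys _ with () ← xs⊆ys (here refl)
increasing-⊆-≡ {x ∷ xs} {y ∷ ys} (x<xs ∷ xs↗) (y<ys ∷ ys↗) xs⊆ys ys⊆xs =
  cong₂ _∷_ x≡y (increasing-⊆-≡ xs↗ ys↗ (⊆-tail x≡y x<xs xs⊆ys) (⊆-tail (sym x≡y) y<ys ys⊆xs))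
  where
  head-≤ : ∀ {z zs w} → All (z <_) zs → w ∈ z ∷ zs → z ≤ w
  head-≤ _    (here refl)  = ℕₚ.≤-refl
  head-≤ z<zs (there w∈zs) = ℕₚ.<⇒≤ (All.lookup z<zs w∈zs)
  x≡y : x ≡ y
  x≡y = ℕₚ.≤-antisym (head-≤ x<xs (ys⊆xs (here refl))) (head-≤ y<ys (xs⊆ys (here refl)))
  ⊆-tail : ∀ {z w zs ws} → z ≡ w → All (z <_) zs → z ∷ zs ⊆ w ∷ ws → zs ⊆ ws
  ⊆-tail refl z<zs sub v∈zs with sub (there v∈zs)
  ... | here refl  = contradiction (All.lookup z<zs v∈zs) (ℕₚ.<-irrefl refl)
  ... | there v∈ws = v∈ws

range1-increasing : AllPairs _<_ (range1 m)
range1-increasing {m} = AllPairs.map⁺ (AllPairs.applyUpTo⁺₁ id m (λ i<j _ → s<s i<j))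

∈-range1⁻ : d ∈ range1 m → NonZero d
∈-range1⁻ d∈ with _ , _ , refl ← ∈-map⁻ suc d∈ = _

∈-range1⁺ : .{{NonZero d}} → d ≤ m → d ∈ range1 m
∈-range1⁺ {suc d} d<m = ∈-map⁺ suc (∈-upTo⁺ d<m)

divisors-increasing : ∀ m → AllPairs _<_ (divisors m)
divisors-increasing m = AllPairs.filter⁺ (_∣? m) (range1-increasing {m})

∈-divisors⁻ : d ∈ divisors m → NonZero d × d ∣ m
∈-divisors⁻ {m = m} d∈ with d∈range , d∣m ← ∈-filter⁻ (_∣? m) {xs = range1 m} d∈ = ∈-range1⁻ d∈range , d∣m

∈-divisors⁺ : .{{NonZero m}} → .{{NonZero d}} → d ∣ m → d ∈ divisors m
∈-divisors⁺ {m} d∣m = ∈-filter⁺ (_∣? m) (∈-range1⁺ (∣⇒≤ d∣m)) d∣m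

primeDivisors-increasing : ∀ m → AllPairs _<_ (primeDivisors m)
primeDivisors-increasing m = AllPairs.filter⁺ (λ p → prime? p ×-dec (p ∣? m)) (range1-increasing {m})

∈-primeDivisors⁻ : d ∈ primeDivisors m → Prime d × d ∣ m
∈-primeDivisors⁻ {m = m} d∈ = proj₂ (∈-filter⁻ (λ p → prime? p ×-dec (p ∣? m)) {xs = range1 m} d∈)

∈-primeDivisors⁺ : .{{NonZero m}} → Prime d → d ∣ m → d ∈ primeDivisors m
∈-primeDivisors⁺ {m} {d} p d∣m =
  ∈-filter⁺ (λ p → prime? p ×-dec (p ∣? m)) (∈-range1⁺ {{prime⇒nonZero p}} (∣⇒≤ d∣m)) (p , d∣m)

even-divisors : ∀ m → filter (2 ∣?_) (divisors (m * 2)) ≡ map (_* 2) (divisors m)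
even-divisors zero = refl
even-divisors m@(suc _) = increasing-⊆-≡
  (AllPairs.filter⁺ (2 ∣?_) (divisors-increasing (m * 2)))
  (AllPairs.map⁺ (AllPairs.map (ℕₚ.*-monoˡ-< 2) (divisors-increasing m)))
  lhs⊆rhs rhs⊆lhs
  where
  lhs⊆rhs : filter (2 ∣?_) (divisors (m * 2)) ⊆ map (_* 2) (divisors m)
  lhs⊆rhs d∈ with d∈′ , divides e refl ← ∈-filter⁻ (2 ∣?_) {xs = divisors (m * 2)} d∈ =
    let nz , e*2∣m*2 = ∈-divisors⁻ {m = m * 2} d∈′ in
    ∈-map⁺ (_* 2) (∈-divisors⁺ {m = m} {{_}} {{ℕₚ.m*n≢0⇒m≢0 e {{nz}}}} (*-cancelʳ-∣ 2 e*2∣m*2))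
  rhs⊆lhs : map (_* 2) (divisors m) ⊆ filter (2 ∣?_) (divisors (m * 2))
  rhs⊆lhs d∈ with e , e∈ , refl ← ∈-map⁻ (_* 2) d∈ =
    let nz , e∣m = ∈-divisors⁻ {m = m} e∈ in
    ∈-filter⁺ (2 ∣?_) (∈-divisors⁺ {m = m * 2} {{_}} {{ℕₚ.m*n≢0 e 2 {{nz}}}} (*-monoˡ-∣ 2 e∣m)) (n∣m*n e)

primeDivisors-*2 : .{{NonZero e}} → 2 ∤ e → primeDivisors (e * 2) ≡ 2 ∷ primeDivisors e
primeDivisors-*2 {e} 2∤e = increasing-⊆-≡
  (primeDivisors-increasing (e * 2))
  (All.tabulate 2<p ∷ primeDivisors-increasing e)
  lhs⊆rhs rhs⊆lhs
  where
  instance _ = ℕₚ.m*n≢0 e 2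
  2<p : ∀ {p} → p ∈ primeDivisors e → 2 < p
  2<p p∈ with p , p∣e ← ∈-primeDivisors⁻ {m = e} p∈ =
    ℕₚ.≤∧≢⇒< (ℕ.nonTrivial⇒n>1 _ {{prime⇒nonTrivial p}}) λ where refl → 2∤e p∣e
  lhs⊆rhs : primeDivisors (e * 2) ⊆ 2 ∷ primeDivisors e
  lhs⊆rhs p∈ with p , p∣e*2 ← ∈-primeDivisors⁻ {m = e * 2} p∈ with euclidsLemma e 2 p p∣e*2
  ... | inj₁ p∣e = there (∈-primeDivisors⁺ {m = e} p p∣e)
  ... | inj₂ p∣2 with prime⇒irreducible prime[2] p∣2
  ...   | inj₁ refl = contradiction p ¬prime[1]
  ...   | inj₂ refl = here refl
  rhs⊆lhs : 2 ∷ primeDivisors e ⊆ primeDivisors (e * 2)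
  rhs⊆lhs (here refl) = ∈-primeDivisors⁺ {m = e * 2} prime[2] (n∣m*n e)
  rhs⊆lhs (there p∈) with p , p∣e ← ∈-primeDivisors⁻ {m = e} p∈ = ∈-primeDivisors⁺ {m = e * 2} p (∣m⇒∣m*n 2 p∣e)

-- The Möbius function

noSquareDivides : ℕ → List ℕ → Bool
noSquareDivides d []       = true
noSquareDivides d (p ∷ ps) = if does (p * p ∣? d) then false else noSquareDivides d ps

-- squareFree recurses through a helper local to its where-block, which cannot be
-- named; any function obeying the same two equations agrees with it.
squareFree-unfold : ∀ d → squareFree d ≡ noSquareDivides d (primeDivisors d)
squareFree-unfold d with primeDivisors d | noSquareDivides-unique refl (λ _ _ → refl)
  where
  noSquareDivides-unique : {f : List ℕ → Bool} → f [] ≡ true →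
    (∀ p ps → f (p ∷ ps) ≡ (if does (p * p ∣? d) then false else f ps)) →
    ∀ ps → f ps ≡ noSquareDivides d ps
  noSquareDivides-unique f[] f∷ []       = f[]
  noSquareDivides-unique f[] f∷ (p ∷ ps) =
    trans (f∷ p ps) (cong (if does (p * p ∣? d) then false else_) (noSquareDivides-unique f[] f∷ ps))
... | ps | unique = unique ps

noSquareDivides-false : ∀ {p ps} → p ∈ ps → p * p ∣ d → noSquareDivides d ps ≡ false
noSquareDivides-false {d} {p} (here refl) p²∣d rewrite dec-true (p * p ∣? d) p²∣d = refl
noSquareDivides-false {d} {ps = p ∷ _} (there p∈) p²∣d with does (p * p ∣? d)
... | true  = refl
... | false = noSquareDivides-false p∈ p²∣d

noSquareDivides-cong : ∀ {d′ ps} → (∀ {p} → p ∈ ps → p * p ∣ d ⇔ p * p ∣ d′) →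
                       noSquareDivides d ps ≡ noSquareDivides d′ ps
noSquareDivides-cong {ps = []}     _ = refl
noSquareDivides-cong {d} {d′} {p ∷ ps} p²∣d⇔p²∣d′ = cong₂ (λ b r → if b then false else r)
  (does-⇔ (p²∣d⇔p²∣d′ (here refl)) (p * p ∣? d) (p * p ∣? d′))
  (noSquareDivides-cong (p²∣d⇔p²∣d′ ∘ there))

squareFree-*2 : .{{NonZero e}} → 2 ∤ e → squareFree (e * 2) ≡ squareFree e
squareFree-*2 {e} 2∤e = begin
  squareFree (e * 2)                              ≡⟨ squareFree-unfold (e * 2) ⟩
  noSquareDivides (e * 2) (primeDivisors (e * 2)) ≡⟨ cong (noSquareDivides (e * 2)) (primeDivisors-*2 2∤e) ⟩
  noSquareDivides (e * 2) (2 ∷ primeDivisors e)   ≡⟨ cong (λ b → if b then false else noSquareDivides (e * 2) (primeDivisors e)) (dec-false (2 * 2 ∣? e * 2) (2∤⇒4∤*2 2∤e)) ⟩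
  noSquareDivides (e * 2) (primeDivisors e)       ≡⟨ noSquareDivides-cong p²∣e*2⇔p²∣e ⟩
  noSquareDivides e (primeDivisors e)             ≡⟨ squareFree-unfold e ⟨
  squareFree e                                    ∎
  where
  open ≡-Reasoning
  p²∣e*2⇔p²∣e : ∀ {p} → p ∈ primeDivisors e → p * p ∣ e * 2 ⇔ p * p ∣ e
  p²∣e*2⇔p²∣e {p} p∈ = mk⇔
    (coprime-divisor (2∤m⇒coprime[m,2] 2∤p²) ∘ subst (p * p ∣_) (ℕₚ.*-comm e 2))
    (∣m⇒∣m*n 2)
    where
    2∤p : 2 ∤ p
    2∤p 2∣p = 2∤e (∣-trans 2∣p (proj₂ (∈-primeDivisors⁻ {m = e} p∈)))
    2∤p² : 2 ∤ p * p
    2∤p² = Equivalence.from 2∤m*n⇔2∤m×2∤n (2∤p , 2∤p)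

μ-4∣ : .{{NonZero d}} → 2 * 2 ∣ d → μ d ≡ 0ℤ
μ-4∣ {d} 4∣d = cong (λ b → if b then -1ℤ ℤ.^ length (primeDivisors d) else + 0) (trans (squareFree-unfold d)
  (noSquareDivides-false (∈-primeDivisors⁺ prime[2] (∣-trans (∣m⇒∣m*n 2 ∣-refl) 4∣d)) 4∣d))

μ-*2 : .{{NonZero e}} → 2 ∤ e → μ (e * 2) ≡ ℤ.- μ e
μ-*2 {e} 2∤e = begin
  μ (e * 2)
    ≡⟨ cong₂ (λ b ps → if b then -1ℤ ℤ.^ length ps else + 0) (squareFree-*2 2∤e) (primeDivisors-*2 2∤e) ⟩
  (if squareFree e then -1ℤ ℤ.* (-1ℤ ℤ.^ length (primeDivisors e)) else + 0)
    ≡⟨ negate-if (squareFree e) ⟩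
  ℤ.- μ e ∎
  where
  open ≡-Reasoning
  negate-if : ∀ b {i} → (if b then -1ℤ ℤ.* i else + 0) ≡ ℤ.- (if b then i else + 0)
  negate-if true  = ℤₚ.-1*i≡-i _
  negate-if false = refl

signedμ : ℕ → ℕ → ℤ
signedμ t d = sgn t ℤ.* (μ d ℤ.* sgn (divBy d t))

divBy-* : .{{NonZero d}} → d ∣ t → divBy d t * d ≡ t
divBy-* {suc _} d∣t = m/n*n≡m d∣t

signedμ-untwisted : .{{NonZero d}} → d ∣ t → ¬ (t % 4 ≡ 2 × 2 ∣ d) → signedμ t d ≡ μ d
signedμ-untwisted {d} {t} d∣t ¬twisted with 2 * 2 ∣? d
... | yes 4∣d rewrite μ-4∣ 4∣d = ℤₚ.*-zeroʳ (sgn t)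
... | no  4∤d = begin
  sgn t ℤ.* (μ d ℤ.* sgn t/d)   ≡⟨ cong (ℤ._* (μ d ℤ.* sgn t/d)) (sgn-quotient {q = t/d} (divBy-* d∣t) 4∤d ¬twisted) ⟩
  sgn t/d ℤ.* (μ d ℤ.* sgn t/d) ≡⟨ ℤ-x*yz≡y*xz (sgn t/d) (μ d) (sgn t/d) ⟩
  μ d ℤ.* (sgn t/d ℤ.* sgn t/d) ≡⟨ cong (μ d ℤ.*_) (sgn*sgn≡1 t/d) ⟩
  μ d ℤ.* 1ℤ                    ≡⟨ ℤₚ.*-identityʳ (μ d) ⟩
  μ d                           ∎
  where
  open ≡-Reasoning
  t/d = divBy d t

signedμ-twisted : .{{NonZero d}} → d ∣ t → t % 4 ≡ 2 → 2 ∣ d → signedμ t d ≡ ℤ.- μ d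
signedμ-twisted {d} {t} d∣t t%4≡2 2∣d = begin
  sgn t ℤ.* (μ d ℤ.* sgn (divBy d t)) ≡⟨ cong₂ (λ s s′ → s ℤ.* (μ d ℤ.* s′)) (sgn-even (∣-trans 2∣d d∣t))
                                          (sgn-odd (quotient-odd {q = divBy d t} (divBy-* d∣t) t%4≡2 2∣d)) ⟩
  1ℤ ℤ.* (μ d ℤ.* -1ℤ)               ≡⟨ ℤₚ.*-identityˡ _ ⟩
  μ d ℤ.* -1ℤ                         ≡⟨ ℤₚ.*-comm (μ d) -1ℤ ⟩
  -1ℤ ℤ.* μ d                         ≡⟨ ℤₚ.-1*i≡-i (μ d) ⟩
  ℤ.- μ d                             ∎
  where open ≡-Reasoning

-- Rational arithmetic

ℤtoℚ-neg : ∀ i → ℤtoℚ (ℤ.- i) ≡ ℚ.- ℤtoℚ i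
ℤtoℚ-neg (+ 0)    = refl
ℤtoℚ-neg +[1+ _ ] = refl
ℤtoℚ-neg -[1+ _ ] = sym (ℚ-neg-involutive _)

ℤtoℚ-* : ∀ i j → ℤtoℚ (i ℤ.* j) ≡ ℤtoℚ i ℚ.* ℤtoℚ j
ℤtoℚ-* i j = ℚₚ.toℚᵘ-injective (begin
  ℚ.toℚᵘ (ℤtoℚ (i ℤ.* j))           ≈⟨ ℚₚ.toℚᵘ-fromℚᵘ (ℚᵘ.mkℚᵘ (i ℤ.* j) 0) ⟩
  ℚᵘ.mkℚᵘ i 0 ℚᵘ.* ℚᵘ.mkℚᵘ j 0      ≈⟨ ℚᵘₚ.*-cong (ℚₚ.toℚᵘ-fromℚᵘ (ℚᵘ.mkℚᵘ i 0)) (ℚₚ.toℚᵘ-fromℚᵘ (ℚᵘ.mkℚᵘ j 0)) ⟨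
  ℚ.toℚᵘ (ℤtoℚ i) ℚᵘ.* ℚ.toℚᵘ (ℤtoℚ j) ≈⟨ ℚₚ.toℚᵘ-homo-* (ℤtoℚ i) (ℤtoℚ j) ⟨
  ℚ.toℚᵘ (ℤtoℚ i ℚ.* ℤtoℚ j)        ∎)
  where open ℚᵘₚ.≃-Reasoning

sumℚ-map-cong : ∀ {f g : A → ℚ.ℚ} {xs} → (∀ {x} → x ∈ xs → f x ≡ g x) → sumℚ (map f xs) ≡ sumℚ (map g xs)
sumℚ-map-cong f≗g = cong sumℚ (map-cong-local (All.tabulate f≗g))

sumℚ-map-+ : ∀ (f g : A → ℚ.ℚ) xs → sumℚ (map (λ x → f x + g x) xs) ≡ sumℚ (map f xs) + sumℚ (map g xs)
sumℚ-map-+ f g []       = refl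
sumℚ-map-+ f g (x ∷ xs) = trans (cong (_+_ (f x + g x)) (sumℚ-map-+ f g xs))
  (ℚ-+-interchange (f x) (g x) (sumℚ (map f xs)) (sumℚ (map g xs)))

*-sumℚ-map : ∀ c (f : A → ℚ.ℚ) xs → c ℚ.* sumℚ (map f xs) ≡ sumℚ (map (λ x → c ℚ.* f x) xs)
*-sumℚ-map c f []       = ℚₚ.*-zeroʳ c
*-sumℚ-map c f (x ∷ xs) = trans (ℚₚ.*-distribˡ-+ c (f x) _) (cong (_+_ (c ℚ.* f x)) (*-sumℚ-map c f xs))

sumℚ-map-if : ∀ {ℓ} {P : Pred A ℓ} (P? : Decidable P) (f : A → ℚ.ℚ) xs →
  sumℚ (map (λ x → if does (P? x) then f x else ℚ.0ℚ) xs) ≡ sumℚ (map f (filter P? xs))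
sumℚ-map-if P? f []       = refl
sumℚ-map-if P? f (x ∷ xs) with does (P? x)
... | true  = cong (_+_ (f x)) (sumℚ-map-if P? f xs)
... | false = trans (ℚₚ.+-identityˡ _) (sumℚ-map-if P? f xs)

*-divℚ : ∀ c x n → c ℚ.* divℚ x n ≡ divℚ (c ℚ.* x) n
*-divℚ c x zero    = ℚₚ.*-zeroʳ c
*-divℚ c x (suc n) = sym (ℚₚ.*-assoc c x _)

divℚ-+ : ∀ x y n → divℚ (x + y) n ≡ divℚ x n + divℚ y n
divℚ-+ x y zero    = refl
divℚ-+ x y (suc n) = ℚₚ.*-distribʳ-+ _ x y

1/[m*2]+1/[m*2]≡1/m : ∀ k → + 1 ℚ./ (suc k * 2) + + 1 ℚ./ (suc k * 2) ≡ + 1 ℚ./ suc k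
1/[m*2]+1/[m*2]≡1/m k = ℚₚ.toℚᵘ-injective (begin
  ℚ.toℚᵘ (1/2m + 1/2m)           ≈⟨ ℚₚ.toℚᵘ-homo-+ 1/2m 1/2m ⟩
  ℚ.toℚᵘ 1/2m ℚᵘ.+ ℚ.toℚᵘ 1/2m    ≈⟨ ℚᵘₚ.+-cong 1/2m≃ 1/2m≃ ⟩
  1/2mᵘ ℚᵘ.+ 1/2mᵘ                ≈⟨ ℚᵘ.*≡* (cong +_ (cross-multiplied k)) ⟩
  ℚᵘ.mkℚᵘ (+ 1) k                 ≈⟨ ℚₚ.toℚᵘ-fromℚᵘ (ℚᵘ.mkℚᵘ (+ 1) k) ⟨
  ℚ.toℚᵘ (+ 1 ℚ./ suc k)          ∎)
  where
  open ℚᵘₚ.≃-Reasoning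
  1/2m = + 1 ℚ./ (suc k * 2)
  1/2mᵘ = ℚᵘ.mkℚᵘ (+ 1) (ℕ.pred (suc k * 2))
  1/2m≃ = ℚₚ.toℚᵘ-fromℚᵘ 1/2mᵘ
  cross-multiplied : ∀ k → let d = suc k * 2 in (1 * d ℕ.+ 1 * d) * suc k ≡ 1 * (d * d)
  cross-multiplied = solve-∀

divℚ-double : ∀ x m .{{_ : NonZero m}} → divℚ (x + x) (m * 2) ≡ divℚ x m
divℚ-double x m@(suc k) = begin
  (x + x) ℚ.* 1/2m            ≡⟨ ℚₚ.*-distribʳ-+ 1/2m x x ⟩
  x ℚ.* 1/2m + x ℚ.* 1/2m     ≡⟨ ℚₚ.*-distribˡ-+ x 1/2m 1/2m ⟨
  x ℚ.* (1/2m + 1/2m)         ≡⟨ cong (x ℚ.*_) (1/[m*2]+1/[m*2]≡1/m k) ⟩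
  x ℚ.* (+ 1 ℚ./ m)           ∎
  where
  open ≡-Reasoning
  1/2m = + 1 ℚ./ (m * 2)

-- Scaling all parts

∣gcdList⇒All∣ : d ∣ gcdList ns → All (d ∣_) ns
∣gcdList⇒All∣ {ns = []}     _   = []
∣gcdList⇒All∣ {ns = n ∷ ns} d∣g =
  ∣-trans d∣g (gcd[m,n]∣m n _) ∷ ∣gcdList⇒All∣ (∣-trans d∣g (gcd[m,n]∣n n _))

All∣⇒∣sum : All (d ∣_) ns → d ∣ sum ns
All∣⇒∣sum {d} []            = d ∣0
All∣⇒∣sum (d∣n ∷ d∣ns) = ∣m∣n⇒∣m+n d∣n (All∣⇒∣sum d∣ns)

∣gcdList⇒∣tk : ∀ k → d ∣ gcdList ns → d ∣ tk k ns
∣gcdList⇒∣tk k d∣g = All∣⇒∣sum (All.take⁺ k (∣gcdList⇒All∣ d∣g))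

halve-*2 : All (2 ∣_) ns → map (_* 2) (halve ns) ≡ ns
halve-*2 []           = refl
halve-*2 (2∣n ∷ 2∣ns) = cong₂ _∷_ (m/n*n≡m 2∣n) (halve-*2 2∣ns)

sum-map-* : ∀ c ns → sum (map (_* c) ns) ≡ sum ns * c
sum-map-* c []       = refl
sum-map-* c (n ∷ ns) = trans (cong (n * c ℕ.+_) (sum-map-* c ns)) (sym (ℕₚ.*-distribʳ-+ c n (sum ns)))

gcdList-map-* : ∀ c ns → gcdList (map (_* c) ns) ≡ gcdList ns * c
gcdList-map-* c []       = refl
gcdList-map-* c (n ∷ ns) = begin
  gcd (n * c) (gcdList (map (_* c) ns)) ≡⟨ cong₂ gcd (ℕₚ.*-comm n c) (trans (gcdList-map-* c ns) (ℕₚ.*-comm _ c)) ⟩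
  gcd (c * n) (c * gcdList ns)          ≡⟨ c*gcd[m,n]≡gcd[cm,cn] c n (gcdList ns) ⟨
  c * gcd n (gcdList ns)                ≡⟨ ℕₚ.*-comm c _ ⟩
  gcd n (gcdList ns) * c                ∎
  where open ≡-Reasoning

divBy-*-cancel : ∀ c .{{_ : NonZero c}} e .{{_ : NonZero e}} m → divBy (e * c) (m * c) ≡ divBy e m
divBy-*-cancel c@(suc _) e@(suc _) m = m*n/o*n≡m/o m c e

multinom-map-* : ∀ c .{{_ : NonZero c}} e .{{_ : NonZero e}} ns →
                 multinom (map (_* c) ns) (e * c) ≡ multinom ns e
multinom-map-* c e ns = cong₂ ℚ._*_
  (cong (λ n → ℕtoℚ (n ℕ.!)) (trans (cong (divBy (e * c)) (sum-map-* c ns)) (divBy-*-cancel c e (sum ns))))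
  (cong prodℚ (trans (sym (map-∘ ns)) (map-cong-local (All.tabulate λ {m} _ → cong invFact (divBy-*-cancel c e m)))))

-- M and V as sums over the divisors of the gcd

term : (ℕ → ℤ) → List ℕ → ℕ → ℚ.ℚ
term c ns d = ℤtoℚ (c d) ℚ.* multinom ns d

-- M ns is divisorSum μ ns by definition.
divisorSum : (ℕ → ℤ) → List ℕ → ℚ.ℚ
divisorSum c ns = divℚ (sumℚ (map (term c ns) (divisors (gcdList ns)))) (sum ns)

divisorSum-cong : ∀ {c c′} ns → (∀ {d} → d ∈ divisors (gcdList ns) → c d ≡ c′ d) →
                  divisorSum c ns ≡ divisorSum c′ ns
divisorSum-cong ns c≗c′ = cong (λ S → divℚ S (sum ns))
  (sumℚ-map-cong {xs = divisors (gcdList ns)} λ d∈ → cong (λ i → ℤtoℚ i ℚ.* _) (c≗c′ d∈))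

V≡divisorSum : ∀ k ns → V k ns ≡ divisorSum (signedμ (tk k ns)) ns
V≡divisorSum k ns = begin
  ℤtoℚ s ℚ.* divℚ (sumℚ (map (λ d → ℤtoℚ (μ d ℤ.* sgn (divBy d tₖ)) ℚ.* multinom ns d) ds)) (sum ns)
    ≡⟨ *-divℚ (ℤtoℚ s) _ (sum ns) ⟩
  divℚ (ℤtoℚ s ℚ.* sumℚ (map (λ d → ℤtoℚ (μ d ℤ.* sgn (divBy d tₖ)) ℚ.* multinom ns d) ds)) (sum ns)
    ≡⟨ cong (λ S → divℚ S (sum ns)) (trans (*-sumℚ-map (ℤtoℚ s) _ ds) (sumℚ-map-cong {xs = ds} λ {d} _ → absorb-sign d)) ⟩
  divisorSum (signedμ tₖ) ns ∎
  where
  open ≡-Reasoning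
  tₖ = tk k ns
  s = sgn tₖ
  ds = divisors (gcdList ns)
  absorb-sign : ∀ d → ℤtoℚ s ℚ.* (ℤtoℚ (μ d ℤ.* sgn (divBy d tₖ)) ℚ.* multinom ns d) ≡ term (signedμ tₖ) ns d
  absorb-sign d = trans (sym (ℚₚ.*-assoc (ℤtoℚ s) _ _)) (cong (ℚ._* multinom ns d) (sym (ℤtoℚ-* s _)))

V≡M : ∀ k ns → ¬ (tk k ns % 4 ≡ 2 × 2 ∣ gcdList ns) → V k ns ≡ M ns
V≡M k ns ¬twisted = trans (V≡divisorSum k ns) (divisorSum-cong ns λ d∈ →
  let nz , d∣g = ∈-divisors⁻ d∈ in
  signedμ-untwisted {{nz}} (∣gcdList⇒∣tk k d∣g) λ (t%4≡2 , 2∣d) → ¬twisted (t%4≡2 , ∣-trans 2∣d d∣g))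

neg-term-*2 : ∀ ns .{{_ : NonZero e}} → 2 ∤ e → ℚ.- term μ (map (_* 2) ns) (e * 2) ≡ term μ ns e
neg-term-*2 {e} ns 2∤e = begin
  ℚ.- (ℤtoℚ (μ (e * 2)) ℚ.* multinom (map (_* 2) ns) (e * 2))
    ≡⟨ cong₂ (λ i T → ℚ.- (ℤtoℚ i ℚ.* T)) (μ-*2 2∤e) (multinom-map-* 2 e ns) ⟩
  ℚ.- (ℤtoℚ (ℤ.- μ e) ℚ.* multinom ns e)
    ≡⟨ cong (λ x → ℚ.- (x ℚ.* multinom ns e)) (ℤtoℚ-neg (μ e)) ⟩
  ℚ.- (ℚ.- ℤtoℚ (μ e) ℚ.* multinom ns e)
    ≡⟨ cong ℚ.-_ (ℚₚ.neg-distribˡ-* (ℤtoℚ (μ e)) (multinom ns e)) ⟨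
  ℚ.- ℚ.- (ℤtoℚ (μ e) ℚ.* multinom ns e)
    ≡⟨ ℚ-neg-involutive _ ⟩
  term μ ns e ∎
  where open ≡-Reasoning

-x≡x+[-x+-x] : ∀ x → ℚ.- x ≡ x + (ℚ.- x + ℚ.- x)
-x≡x+[-x+-x] x = begin
  ℚ.- x                  ≡⟨ ℚₚ.+-identityˡ (ℚ.- x) ⟨
  ℚ.0ℚ + ℚ.- x           ≡⟨ cong (_+ ℚ.- x) (ℚₚ.+-inverseʳ x) ⟨
  (x + ℚ.- x) + ℚ.- x    ≡⟨ ℚₚ.+-assoc x (ℚ.- x) (ℚ.- x) ⟩
  x + (ℚ.- x + ℚ.- x)    ∎
  where open ≡-Reasoning

module Twisted (k : ℕ) (ns : List ℕ) (t%4≡2 : tk k ns % 4 ≡ 2) (2∣g : 2 ∣ gcdList ns) where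

  private
    tₖ = tk k ns
    hs = halve ns
    h = gcdList hs
    ds = divisors (gcdList ns)

    hs*2≡ns : map (_* 2) hs ≡ ns
    hs*2≡ns = halve-*2 (∣gcdList⇒All∣ 2∣g)

    g≡h*2 : gcdList ns ≡ h * 2
    g≡h*2 = trans (cong gcdList (sym hs*2≡ns)) (gcdList-map-* 2 hs)

    2∤h : 2 ∤ h
    2∤h with divides c tₖ≡c*g ← ∣gcdList⇒∣tk {ns = ns} k ∣-refl =
      proj₂ (Equivalence.to ([q*[e*2]]%4≡2⇔2∤q×2∤e {c} {h}) [c*[h*2]]%4≡2)
      where
      [c*[h*2]]%4≡2 : c * (h * 2) % 4 ≡ 2
      [c*[h*2]]%4≡2 = subst (λ x → x % 4 ≡ 2) (trans tₖ≡c*g (cong (c *_) g≡h*2)) t%4≡2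

    −2term : ℕ → ℚ.ℚ
    −2term d = ℚ.- term μ ns d + ℚ.- term μ ns d

    correction : ℕ → ℚ.ℚ
    correction d = if does (2 ∣? d) then −2term d else ℚ.0ℚ

    term-signedμ : ∀ {d} → d ∈ ds → term (signedμ tₖ) ns d ≡ term μ ns d + correction d
    term-signedμ {d} d∈ with ∈-divisors⁻ d∈ | 2 ∣? d
    ... | nz , d∣g | no 2∤d = begin
      term (signedμ tₖ) ns d     ≡⟨ cong (λ i → ℤtoℚ i ℚ.* multinom ns d) (signedμ-untwisted {{nz}} d∣tₖ (2∤d ∘ proj₂)) ⟩
      term μ ns d                ≡⟨ ℚₚ.+-identityʳ _ ⟨
      term μ ns d + ℚ.0ℚ         ≡⟨ cong (λ b → term μ ns d + (if b then −2term d else ℚ.0ℚ)) (dec-false (2 ∣? d) 2∤d) ⟨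
      term μ ns d + correction d ∎
      where
      open ≡-Reasoning
      d∣tₖ = ∣gcdList⇒∣tk k d∣g
    ... | nz , d∣g | yes 2∣d = begin
      term (signedμ tₖ) ns d           ≡⟨ cong (λ i → ℤtoℚ i ℚ.* multinom ns d) (signedμ-twisted {{nz}} (∣gcdList⇒∣tk k d∣g) t%4≡2 2∣d) ⟩
      ℤtoℚ (ℤ.- μ d) ℚ.* multinom ns d ≡⟨ cong (ℚ._* multinom ns d) (ℤtoℚ-neg (μ d)) ⟩
      ℚ.- ℤtoℚ (μ d) ℚ.* multinom ns d ≡⟨ ℚₚ.neg-distribˡ-* (ℤtoℚ (μ d)) (multinom ns d) ⟨
      ℚ.- term μ ns d                  ≡⟨ -x≡x+[-x+-x] (term μ ns d) ⟩
      term μ ns d + −2term d           ≡⟨ cong (λ b → term μ ns d + (if b then −2term d else ℚ.0ℚ)) (dec-true (2 ∣? d) 2∣d) ⟨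
      term μ ns d + correction d       ∎
      where open ≡-Reasoning

    Σ-correction : sumℚ (map correction ds) ≡ sumℚ (map (term μ hs) (divisors h)) + sumℚ (map (term μ hs) (divisors h))
    Σ-correction = begin
      sumℚ (map correction ds)                             ≡⟨ sumℚ-map-if (2 ∣?_) −2term ds ⟩
      sumℚ (map −2term (filter (2 ∣?_) ds))                ≡⟨ cong (sumℚ ∘ map −2term) evens ⟩
      sumℚ (map −2term (map (_* 2) (divisors h)))          ≡⟨ cong sumℚ (map-∘ (divisors h)) ⟨
      sumℚ (map (−2term ∘ (_* 2)) (divisors h))            ≡⟨ sumℚ-map-cong {xs = divisors h} −2term-*2 ⟩
      sumℚ (map (λ e → term μ hs e + term μ hs e) (divisors h)) ≡⟨ sumℚ-map-+ (term μ hs) (term μ hs) (divisors h) ⟩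
      sumℚ (map (term μ hs) (divisors h)) + sumℚ (map (term μ hs) (divisors h)) ∎
      where
      open ≡-Reasoning
      evens : filter (2 ∣?_) ds ≡ map (_* 2) (divisors h)
      evens = trans (cong (filter (2 ∣?_) ∘ divisors) g≡h*2) (even-divisors h)
      −2term-*2 : ∀ {e} → e ∈ divisors h → −2term (e * 2) ≡ term μ hs e + term μ hs e
      −2term-*2 {e} e∈ = cong (λ x → x + x) (subst (λ ms → ℚ.- term μ ms (e * 2) ≡ term μ hs e) hs*2≡ns
        (neg-term-*2 hs {{proj₁ (∈-divisors⁻ {m = h} e∈)}} (2∤h ∘ λ 2∣e → ∣-trans 2∣e (proj₂ (∈-divisors⁻ {m = h} e∈)))))

  V≡M+M[halve] : 1 ≤ sum ns → V k ns ≡ M ns + M hs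
  V≡M+M[halve] 1≤n = begin
    V k ns                                        ≡⟨ V≡divisorSum k ns ⟩
    divℚ (sumℚ (map (term (signedμ tₖ) ns) ds)) (sum ns)
      ≡⟨ cong (λ S → divℚ S (sum ns)) (trans (sumℚ-map-cong {xs = ds} term-signedμ) (sumℚ-map-+ (term μ ns) correction ds)) ⟩
    divℚ (S + sumℚ (map correction ds)) (sum ns) ≡⟨ cong (λ S′ → divℚ (S + S′) (sum ns)) Σ-correction ⟩
    divℚ (S + (Sₕ + Sₕ)) (sum ns)                ≡⟨ divℚ-+ S (Sₕ + Sₕ) (sum ns) ⟩
    M ns + divℚ (Sₕ + Sₕ) (sum ns)               ≡⟨ cong (λ n → M ns + divℚ (Sₕ + Sₕ) n) n≡n/2*2 ⟩
    M ns + divℚ (Sₕ + Sₕ) (n/2 * 2)              ≡⟨ cong (_+_ (M ns)) (divℚ-double Sₕ n/2) ⟩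
    M ns + M hs                                  ∎
    where
    open ≡-Reasoning
    S = sumℚ (map (term μ ns) ds)
    Sₕ = sumℚ (map (term μ hs) (divisors h))
    n/2 = sum hs
    n≡n/2*2 : sum ns ≡ n/2 * 2
    n≡n/2*2 = trans (cong sum (sym hs*2≡ns)) (sum-map-* 2 hs)
    instance
      n/2≢0 : NonZero n/2
      n/2≢0 = ℕₚ.m*n≢0⇒m≢0 n/2 {{ℕ.>-nonZero (subst (1 ≤_) n≡n/2*2 1≤n)}}

lemma1 : (r k : ℕ) (ns : Vec ℕ r) →
           1 ≤ k → k ≤ r → 1 ≤ sum (toList ns) →
           ((tk k (toList ns) % 4 ≡ 2 × 2 ∣ gcdList (toList ns)) →
              V k (toList ns) ≡ M (toList ns) + M (halve (toList ns)))
           × (¬ (tk k (toList ns) % 4 ≡ 2 × 2 ∣ gcdList (toList ns)) →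
              V k (toList ns) ≡ M (toList ns))
lemma1 r k ns _ _ 1≤n =
  (λ (t%4≡2 , 2∣g) → Twisted.V≡M+M[halve] k (toList ns) t%4≡2 2∣g 1≤n) , V≡M k (toList ns)
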